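{- For every integer $i\ge 1$, $f(R_i)=i-1$.
   Context: Rooted binary trees $H_i$ are defined recursively: $H_1$ is a single vertex; for $i\ge 2$, $H_i$ has a root $r'_i$ with exactly two children, one a leaf and the other the root of a copy of $H_{i-1}$. Rooted binary trees $R_i$ are defined recursively: $R_1$ is a single vertex; for $i\ge 2$, $R_i$ has a root $r_i$ with exactly two children, one being the root of a copy of $R_{i-1}$ and the other the root of a copy of $H_{i-1}$. For a rooted tree $T_r$, $h(T_r)$ denotes the number of vertices on a longest path in $T_r$ starting at the root $r$; for the empty tree set $h(T_\emptyset)=0$. For a rooted tree $T_r$ with at least two vertices, let $v_1,\ldots,v_{k'}$ be the children of $r$ and $T_{v_i}$ the subtree rooted at $v_i$ (i.e. $v_i$ with its descendants), ordered so that $h(T_{v_1})\ge\cdots\ge h(T_{v_{k'}})$; if $k'$ is even put $k=k'$, otherwise $k=k'+1$ and $T_{v_k}=T_\emptyset$. Then $f(T_r)=0$ if $T_r$ has at most one vertex, and otherwise $f(T_r)=\max\{\sum_{i=1}^{k} f(T_{v_i}),\ \sum_{i=1}^{k/2} h(T_{v_{2i}})\}$. -}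

module Defs where

open import Data.Nat using (ℕ; zero; suc; _+_; _⊔_; _≤ᵇ_)
open import Data.List using (List; []; _∷_; length)
open import Data.Product using (_×_; _,_; proj₁; proj₂)
open import Data.Bool using (if_then_else_)

-- Rooted trees (finite, unordered children given as a list): a vertex with its list of child subtrees.
data Tree : Set where
  node : List Tree → Tree

leaf : Tree
leaf = node []

-- H i = H_i for i ≥ 1 (H 0 is an unused junk value, set to a leaf).
H : ℕ → Tree
H zero          = leaf
H (suc zero)    = leaf
H (suc (suc i)) = node (leaf ∷ H (suc i) ∷ [])

-- R i = R_i for i ≥ 1 (R 0 unused junk, set to a leaf).
R : ℕ → Tree
R zero          = leaf
R (suc zero)    = leaf
R (suc (suc i)) = node (R (suc i) ∷ H (suc i) ∷ [])

-- h(T): number of vertices on a longest root-starting path.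
mutual
  h : Tree → ℕ
  h (node ts) = suc (hs ts)

  hs : List Tree → ℕ
  hs []       = 0
  hs (t ∷ ts) = h t ⊔ hs ts

-- Summaries (h(T_v), f(T_v)) of the children; empty tree is (0 , 0).
insertDesc : ℕ × ℕ → List (ℕ × ℕ) → List (ℕ × ℕ)
insertDesc x [] = x ∷ []
insertDesc x (y ∷ ys) =
  if proj₁ y ≤ᵇ proj₁ x then x ∷ y ∷ ys else y ∷ insertDesc x ys

sortDesc : List (ℕ × ℕ) → List (ℕ × ℕ)
sortDesc []       = []
sortDesc (x ∷ xs) = insertDesc x (sortDesc xs)

padEven : List (ℕ × ℕ) → List (ℕ × ℕ)
padEven xs = go xs xs

  where
  odd : List (ℕ × ℕ) → Data.Bool.Bool
  odd [] = Data.Bool.false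
  odd (_ ∷ ys) = Data.Bool.not (odd ys)
  go : List (ℕ × ℕ) → List (ℕ × ℕ) → List (ℕ × ℕ)
  go ys _ = if odd ys then appendEmpty ys else ys
    where
    appendEmpty : List (ℕ × ℕ) → List (ℕ × ℕ)
    appendEmpty [] = (0 , 0) ∷ []
    appendEmpty (z ∷ zs) = z ∷ appendEmpty zs

sumF : List (ℕ × ℕ) → ℕ
sumF []       = 0
sumF (x ∷ xs) = proj₂ x + sumF xs

-- sum of h over the even positions v_2, v_4, ... (1-indexed)
sumEvenH : List (ℕ × ℕ) → ℕ
sumEvenH []            = 0
sumEvenH (_ ∷ [])      = 0
sumEvenH (_ ∷ y ∷ ys)  = proj₁ y + sumEvenH ys

combine : List (ℕ × ℕ) → ℕ
combine cs = sumF ps ⊔ sumEvenH ps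
  where ps = padEven (sortDesc cs)

mutual
  f : Tree → ℕ
  f (node [])         = 0
  f (node (t ∷ ts))   = combine (summaries (t ∷ ts))

  summaries : List Tree → List (ℕ × ℕ)
  summaries []       = []
  summaries (t ∷ ts) = (h t , f t) ∷ summaries ts

-- Every inner vertex here has exactly two children, and then f(T) = (f(T₁) + f(T₂)) ⊔ h(T₂) with
-- T₂ the lower child.  H_i has height i and f(H_i) = 1 for i ≥ 2, its lower child being a leaf.
-- The children R_i and H_i of the root of R_{i+1} both have height i, so by induction
-- f(R_{i+1}) = (f(R_i) + 1) ⊔ i = i ⊔ i = i.
module Submission where

open import Defs
open import Data.Nat using (ℕ; zero; suc; z≤n; s≤s; _+_; _⊔_; _≤_; _<_; _∸_; _≤ᵇ_)
open import Data.Nat.Properties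
  using (≤-refl; ≤ᵇ⇒≤; ≤⇒≤ᵇ; <⇒≱; +-identityʳ; +-comm; ⊔-idem)
open import Data.Bool using (true; false; T)
open import Data.Empty using (⊥-elim)
open import Data.Product using (_,_)
open import Data.List using ([]; _∷_)
open import Relation.Nullary using (contradiction)
open import Relation.Binary.PropositionalEquality using (_≡_; refl; sym; cong; cong₂; subst)
open Relation.Binary.PropositionalEquality.≡-Reasoning

≤⇒≤ᵇ≡true : ∀ {m n} → m ≤ n → (m ≤ᵇ n) ≡ true
≤⇒≤ᵇ≡true {m} {n} m≤n with m ≤ᵇ n in eq
... | true  = refl
... | false = ⊥-elim (subst T eq (≤⇒≤ᵇ m≤n))

>⇒≤ᵇ≡false : ∀ {m n} → n < m → (m ≤ᵇ n) ≡ false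
>⇒≤ᵇ≡false {m} {n} n<m with m ≤ᵇ n in eq
... | false = refl
... | true  = contradiction (≤ᵇ⇒≤ m n (subst T (sym eq) _)) (<⇒≱ n<m)

f-node₂-≥ : ∀ s t → h t ≤ h s → f (node (s ∷ t ∷ [])) ≡ (f s + f t) ⊔ h t
f-node₂-≥ s t ht≤hs rewrite ≤⇒≤ᵇ≡true ht≤hs =
  cong₂ (λ x y → (f s + x) ⊔ y) (+-identityʳ (f t)) (+-identityʳ (h t))

f-node₂-< : ∀ s t → h s < h t → f (node (s ∷ t ∷ [])) ≡ (f t + f s) ⊔ h s
f-node₂-< s t hs<ht rewrite >⇒≤ᵇ≡false hs<ht =
  cong₂ (λ x y → (f t + x) ⊔ y) (+-identityʳ (f s)) (+-identityʳ (h s))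

h-H : ∀ n → h (H (suc n)) ≡ suc n
h-H zero    = refl
h-H (suc n) rewrite h-H n = refl

f-H : ∀ n → f (H (suc (suc n))) ≡ 1
f-H zero    = refl
f-H (suc n) = begin
  f (node (leaf ∷ H (suc (suc n)) ∷ []))  ≡⟨ f-node₂-< leaf (H (suc (suc n))) leaf<H ⟩
  (f (H (suc (suc n))) + 0) ⊔ 1            ≡⟨ cong (λ x → (x + 0) ⊔ 1) (f-H n) ⟩
  1                                        ∎
  where
  leaf<H : h leaf < h (H (suc (suc n)))
  leaf<H rewrite h-H (suc n) = s≤s (s≤s z≤n)

h-R : ∀ n → h (R (suc n)) ≡ suc n
h-R zero    = refl
h-R (suc n) rewrite h-R n | h-H n = cong (λ m → suc (suc m)) (⊔-idem n)

f-R : ∀ n → f (R (suc n)) ≡ n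
f-R zero          = refl
f-R (suc zero)    = refl
f-R (suc (suc n)) = begin
  f (node (R (suc (suc n)) ∷ H (suc (suc n)) ∷ []))
    ≡⟨ f-node₂-≥ (R (suc (suc n))) (H (suc (suc n))) H≤R ⟩
  (f (R (suc (suc n))) + f (H (suc (suc n)))) ⊔ h (H (suc (suc n)))
    ≡⟨ cong₂ (λ x z → (x + f (H (suc (suc n)))) ⊔ z) (f-R (suc n)) (h-H (suc n)) ⟩
  (suc n + f (H (suc (suc n)))) ⊔ suc (suc n)
    ≡⟨ cong (λ y → (suc n + y) ⊔ suc (suc n)) (f-H n) ⟩
  (suc n + 1) ⊔ suc (suc n)
    ≡⟨ cong (_⊔ suc (suc n)) (+-comm (suc n) 1) ⟩
  suc (suc n) ⊔ suc (suc n)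
    ≡⟨ ⊔-idem (suc (suc n)) ⟩
  suc (suc n)
    ∎
  where
  H≤R : h (H (suc (suc n))) ≤ h (R (suc (suc n)))
  H≤R rewrite h-H (suc n) | h-R (suc n) = ≤-refl

lemma4 : (i : ℕ) → 1 ≤ i → f (R i) ≡ i ∸ 1
lemma4 (suc n) _ = f-R n
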